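{- Let $A$ be a finite non-empty alphabet and let $\mathbf a,\mathbf b$ be non-empty words over $A$ of equal length. Then $\mathbf a:\mathbf a^r::\mathbf b:\mathbf b^r$ holds in the word algebra $(A^+,\cdot,A^+)$. Consequently $\mathbf a:\mathbf a^r::\mathbf a^r:\mathbf a$ holds there.
   Context: $A^+$ is the set of non-empty words over $A$; $(A^+,\cdot,A^+)$ is the algebra with universe $A^+$, concatenation, and a constant symbol for every non-empty word. $\mathbf w^r$ is the reverse of $\mathbf w$. Framework (full, no restriction on variables): a justification is a pair of terms $s\to t$ with every variable of $t$ occurring in $s$; $\uparrow(\mathbf a\to\mathbf b)$ is the set of justifications with $\mathbf a=s(\mathbf o)$, $\mathbf b=t(\mathbf o)$ (evaluated in the algebra) for some assignment $\mathbf o$ of elements to the variables of $s$. $\uparrow(\mathbf a\to\mathbf b:\!\cdot\,\mathbf c\to\mathbf d):=\uparrow(\mathbf a\to\mathbf b)\cap\uparrow(\mathbf c\to\mathbf d)$; a justification is trivial if it lies in all such sets. $\mathbf a\to\mathbf b:\!\cdot\,\mathbf c\to\mathbf d$ holds iff either (a) $\uparrow(\mathbf a\to\mathbf b)\cup\uparrow(\mathbf c\to\mathbf d)$ consists only of trivial justifications, or (b) with $J_{\mathbf e}$ denoting $\uparrow(\mathbf a\to\mathbf b:\!\cdot\,\mathbf c\to\mathbf e)$ minus trivial justifications, $J_{\mathbf d}\neq\emptyset$ and $J_{\mathbf d}\subseteq J_{\mathbf d'}$ implies $J_{\mathbf d'}\subseteq J_{\mathbf d}$ for every element $\mathbf d'$.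 Then $\mathbf a:\mathbf b::\mathbf c:\mathbf d$ iff $\mathbf a\to\mathbf b:\!\cdot\,\mathbf c\to\mathbf d$, $\mathbf b\to\mathbf a:\!\cdot\,\mathbf d\to\mathbf c$, $\mathbf c\to\mathbf d:\!\cdot\,\mathbf a\to\mathbf b$, $\mathbf d\to\mathbf c:\!\cdot\,\mathbf b\to\mathbf a$ all hold. -}

module Defs where

open import Data.Nat using (ℕ; suc)
open import Data.Fin using (Fin)
open import Data.List using (List; []; _∷_; _++_)
open import Data.List.NonEmpty using (List⁺; _⁺++⁺_)
import Data.List.NonEmpty as L⁺
open import Data.List.Membership.Propositional using (_∈_)
open import Data.Product using (Σ; ∃; _×_; _,_)
open import Data.Sum using (_⊎_)
open import Relation.Binary.PropositionalEquality using (_≡_)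
open import Function.Bundles using (_↔_)

FiniteNonEmpty : Set → Set
FiniteNonEmpty A = Σ ℕ λ n → A ↔ Fin (suc n)

module WordAlgebra (A : Set) where

  Word : Set
  Word = List⁺ A

  _ʳ : Word → Word
  w ʳ = L⁺.reverse w

  data Term : Set where
    var   : ℕ → Term
    const : Word → Term
    _·_   : Term → Term → Term

  vars : Term → List ℕ
  vars (var x)   = x ∷ []
  vars (const w) = []
  vars (s · t)   = vars s ++ vars t

  Assignment : Set
  Assignment = ℕ → Word

  ⟦_⟧ : Term → Assignment → Word
  ⟦ var x ⟧   o = o x
  ⟦ const w ⟧ o = w
  ⟦ s · t ⟧   o = ⟦ s ⟧ o ⁺++⁺ ⟦ t ⟧ o

  record Justification : Set where
    constructor _⇒_∣_
    field
      lhs  : Term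
      rhs  : Term
      vars⊆ : ∀ x → x ∈ vars rhs → x ∈ vars lhs
  open Justification public

  JSet : Set₁
  JSet = Justification → Set

  _⊆J_ : JSet → JSet → Set
  P ⊆J Q = ∀ j → P j → Q j

  ↑ : Word → Word → JSet
  ↑ a b j = ∃ λ (o : Assignment) → (⟦ lhs j ⟧ o ≡ a) × (⟦ rhs j ⟧ o ≡ b)

  ↑₂ : Word → Word → Word → Word → JSet
  ↑₂ a b c d j = ↑ a b j × ↑ c d j

  Trivial : Justification → Set
  Trivial j = ∀ a b c d → ↑₂ a b c d j

  Jset : Word → Word → Word → Word → JSet
  Jset a b c e j = ↑₂ a b c e j × (Trivial j → Data.Empty.⊥)
    where import Data.Empty

  ArrowProp : Word → Word → Word → Word → Set
  ArrowProp a b c d =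
    (∀ j → (↑ a b j ⊎ ↑ c d j) → Trivial j)
    ⊎ ((∃ λ j → Jset a b c d j)
       × (∀ (d' : Word) → Jset a b c d ⊆J Jset a b c d' → Jset a b c d' ⊆J Jset a b c d))

  Analogy : Word → Word → Word → Word → Set
  Analogy a b c d =
    ArrowProp a b c d × ArrowProp b a d c × ArrowProp c d a b × ArrowProp d c b a

-- The justification  x₀ · x₁ · … · xₖ → xₖ · … · x₁ · x₀  lies in ↑(w → wʳ) for every word w
-- of length k + 1, and it is functional there: a word of length k + 1 can only be the value of
-- the k + 1 variables on the left if each of them is a single letter, so the right-hand side is
-- forced to be wʳ.  A non-trivial justification that forces the fourth word of a proportion makes
-- the set J_d maximal, since any J_d' ⊇ J_d contains it and hence d' = d.
module Submission where

open import Defs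
open import Data.List.NonEmpty using (length)
open import Data.Product using (_×_)
open import Relation.Binary.PropositionalEquality using (_≡_)

open import Data.Nat using (ℕ; zero; suc; _+_; _≤_; s≤s; z≤n)
open import Data.Nat.Properties using (+-suc; +-identityʳ; suc-injective; ≤-trans; ≤-pred; m≤n+m; <-irrefl; m≢1+n+m; +-mono-≤)
import Data.List as List
open List using ([]; _∷_; _++_; [_])
import Data.List.Properties as List
open import Data.List.NonEmpty as List⁺ using (List⁺; _∷_; _⁺++⁺_; toList; head)
open import Data.List.NonEmpty.Properties using (length-⁺++⁺)
import Data.Vec as Vec
import Data.Vec.Properties as Vec
open import Data.List.Membership.Propositional using (_∈_)
open import Data.List.Membership.Propositional.Properties using (∈-++⁻)
open import Data.List.Relation.Unary.Any using (here; there)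
open import Data.Product using (_,_; proj₁; proj₂)
open import Data.Sum using (inj₁; inj₂)
open import Relation.Nullary using (¬_)
open import Relation.Binary.PropositionalEquality
  using (refl; sym; trans; cong; cong₂; subst; subst₂; _≢_; module ≡-Reasoning)

module _ {a} {A : Set a} where

  toList-injective : {u v : List⁺ A} → toList u ≡ toList v → u ≡ v
  toList-injective {_ ∷ _} {_ ∷ _} refl = refl

  toList-reverse : (w : List⁺ A) → toList (List⁺.reverse w) ≡ List.reverse (toList w)
  toList-reverse w@(_ ∷ _) = begin
    toList (List⁺.fromVec (Vec.reverse (Vec.fromList (toList w))))
      ≡⟨ fromVec-toList (Vec.reverse (Vec.fromList (toList w))) ⟩
    Vec.toList (Vec.reverse (Vec.fromList (toList w)))
      ≡⟨ Vec.toList-reverse (Vec.fromList (toList w)) ⟩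
    List.reverse (Vec.toList (Vec.fromList (toList w)))
      ≡⟨ cong List.reverse (Vec.toList∘fromList (toList w)) ⟩
    List.reverse (toList w) ∎
    where
    open ≡-Reasoning
    fromVec-toList : ∀ {n} (v : Vec.Vec A (suc n)) → toList (List⁺.fromVec v) ≡ Vec.toList v
    fromVec-toList (_ Vec.∷ _) = refl

  reverse-involutive : (w : List⁺ A) → List⁺.reverse (List⁺.reverse w) ≡ w
  reverse-involutive w = toList-injective (begin
    toList (List⁺.reverse (List⁺.reverse w))     ≡⟨ toList-reverse (List⁺.reverse w) ⟩
    List.reverse (toList (List⁺.reverse w))      ≡⟨ cong List.reverse (toList-reverse w) ⟩
    List.reverse (List.reverse (toList w))       ≡⟨ List.reverse-involutive (toList w) ⟩
    toList w                                     ∎)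
    where open ≡-Reasoning

  length-reverse : (w : List⁺ A) → length (List⁺.reverse w) ≡ length w
  length-reverse w = trans (cong List.length (toList-reverse w)) (List.length-reverse (toList w))

  1≤length : (w : List⁺ A) → 1 ≤ length w
  1≤length (_ ∷ _) = s≤s z≤n

  ⁺++⁺-self≢ : (w : List⁺ A) → w ⁺++⁺ w ≢ w
  ⁺++⁺-self≢ w@(_ ∷ _) eq = m≢1+n+m (length w) (sym (trans (sym (length-⁺++⁺ w w)) (cong length eq)))

  short-prefix-singleton : (u v : List⁺ A) → length (u ⁺++⁺ v) ≤ suc (length v) → u ≡ head u ∷ []
  short-prefix-singleton (_ ∷ []) v _ = refl
  short-prefix-singleton (x ∷ y ∷ ys) v le
    with () ← <-irrefl refl (≤-trans (s≤s (m≤n+m (length v) (List.length ys)))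
                             (≤-pred (subst (_≤ suc (length v)) (length-⁺++⁺ (x ∷ y ∷ ys) v) le)))

module _ {A : Set} where
  open WordAlgebra A

  chain : ℕ → ℕ → Term
  chain i zero    = var i
  chain i (suc k) = var i · chain (suc i) k

  reversedChain : ℕ → ℕ → Term
  reversedChain i zero    = var i
  reversedChain i (suc k) = reversedChain (suc i) k · var i

  vars-reversedChain⊆vars-chain : ∀ k i x → x ∈ vars (reversedChain i k) → x ∈ vars (chain i k)
  vars-reversedChain⊆vars-chain zero    i x x∈ = x∈
  vars-reversedChain⊆vars-chain (suc k) i x x∈ with ∈-++⁻ (vars (reversedChain (suc i) k)) x∈
  ... | inj₁ x∈rest   = there (vars-reversedChain⊆vars-chain k (suc i) x x∈rest)
  ... | inj₂ (here p) = here p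

  reversal : ℕ → Justification
  reversal k = chain 0 k ⇒ reversedChain 0 k ∣ vars-reversedChain⊆vars-chain k 0

  suc-≤-length-chain : ∀ k i (o : Assignment) → suc k ≤ length (⟦ chain i k ⟧ o)
  suc-≤-length-chain zero    i o = 1≤length (o i)
  suc-≤-length-chain (suc k) i o =
    subst (suc (suc k) ≤_) (sym (length-⁺++⁺ (o i) (⟦ chain (suc i) k ⟧ o)))
      (+-mono-≤ (1≤length (o i)) (suc-≤-length-chain k (suc i) o))

  reversedChain-reverses : ∀ k i (o : Assignment) → length (⟦ chain i k ⟧ o) ≡ suc k →
    toList (⟦ reversedChain i k ⟧ o) ≡ List.reverse (toList (⟦ chain i k ⟧ o))
  reversedChain-reverses zero i o len with o i | len
  ... | _ ∷ [] | _ = refl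
  ... | _ ∷ _ ∷ _ | ()
  reversedChain-reverses (suc k) i o len = begin
    toList (⟦ reversedChain (suc i) k ⟧ o) ++ toList (o i)
      ≡⟨ cong₂ _++_ (reversedChain-reverses k (suc i) o length-rest) (cong toList letter) ⟩
    List.reverse (toList rest) ++ [ head (o i) ]
      ≡⟨ List.unfold-reverse (head (o i)) (toList rest) ⟨
    List.reverse (head (o i) ∷ toList rest)
      ≡⟨ cong (λ u → List.reverse (toList (u ⁺++⁺ rest))) letter ⟨
    List.reverse (toList (o i ⁺++⁺ rest)) ∎
    where
    open ≡-Reasoning
    rest : Word
    rest = ⟦ chain (suc i) k ⟧ o
    letter : o i ≡ head (o i) ∷ []
    letter = short-prefix-singleton (o i) rest
      (subst (_≤ suc (length rest)) (sym len) (s≤s (suc-≤-length-chain k (suc i) o)))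
    length-rest : length rest ≡ suc k
    length-rest = suc-injective (trans (cong (λ u → length (u ⁺++⁺ rest)) (sym letter)) len)

  reversedChain-forced : ∀ k (o : Assignment) {w : Word} → ⟦ chain 0 k ⟧ o ≡ w → length w ≡ suc k →
    ⟦ reversedChain 0 k ⟧ o ≡ w ʳ
  reversedChain-forced k o refl len =
    toList-injective (trans (reversedChain-reverses k 0 o len) (sym (toList-reverse (⟦ chain 0 k ⟧ o))))

  -- beyond the end of w the last letter is repeated; those values are never looked up
  letters : Word → Assignment
  letters (x ∷ _)      zero    = x ∷ []
  letters (x ∷ [])     (suc j) = x ∷ []
  letters (_ ∷ y ∷ ys) (suc j) = letters (y ∷ ys) j

  chain-spells : ∀ k i (o : Assignment) (w : Word) → length w ≡ suc k →
    (∀ j → o (i + j) ≡ letters w j) → ⟦ chain i k ⟧ o ≡ w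
  chain-spells zero    i o (x ∷ [])     _   oᵢ₊ = trans (cong o (sym (+-identityʳ i))) (oᵢ₊ 0)
  chain-spells (suc k) i o (x ∷ y ∷ ys) len oᵢ₊ =
    cong₂ _⁺++⁺_ (trans (cong o (sym (+-identityʳ i))) (oᵢ₊ 0))
      (chain-spells k (suc i) o (y ∷ ys) (suc-injective len)
        (λ j → trans (cong o (sym (+-suc i j))) (oᵢ₊ (suc j))))

  Determines : Justification → Word → Word → Set
  Determines j c d = ↑ c d j × (∀ d' → ↑ c d' j → d' ≡ d)

  reversal-determines : ∀ k (w : Word) → length w ≡ suc k → Determines (reversal k) w (w ʳ)
  reversal-determines k w len =
      (letters w , spelled , reversedChain-forced k (letters w) spelled len)
    , λ { d' (o , chain≡w , reversed≡d') → trans (sym reversed≡d') (reversedChain-forced k o chain≡w len) }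
    where
    spelled : ⟦ chain 0 k ⟧ (letters w) ≡ w
    spelled = chain-spells k 0 (letters w) w len (λ _ → refl)

  determines⇒nonTrivial : ∀ {j w d} → Determines j w d → ¬ Trivial j
  determines⇒nonTrivial {j} {w} (_ , unique) trivial =
    ⁺++⁺-self≢ w (trans (unique (w ⁺++⁺ w) (proj₂ (trivial w w w (w ⁺++⁺ w))))
                        (sym (unique w (proj₂ (trivial w w w w)))))

  arrowProp-determined : ∀ {j a b c d} → ↑ a b j → Determines j c d → ArrowProp a b c d
  arrowProp-determined {j} {a} {b} {c} {d} ab det@(cd , unique) =
    inj₂ ((j , (ab , cd) , nonTrivial) , maximal)
    where
    nonTrivial : ¬ Trivial j
    nonTrivial = determines⇒nonTrivial {j} {c} {d} det
    maximal : ∀ d' → Jset a b c d ⊆J Jset a b c d' → Jset a b c d' ⊆J Jset a b c d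
    maximal d' sub = subst (λ e → Jset a b c d' ⊆J Jset a b c e)
      (unique d' (proj₂ (proj₁ (sub j ((ab , cd) , nonTrivial))))) (λ _ j∈ → j∈)

  arrowProp-reverse : (a b : Word) → length a ≡ length b → ArrowProp a (a ʳ) b (b ʳ)
  arrowProp-reverse a@(_ ∷ xs) b len =
    arrowProp-determined {reversal k} {a} {a ʳ} {b} {b ʳ}
      (proj₁ (reversal-determines k a refl)) (reversal-determines k b (sym len))
    where
    k : ℕ
    k = List.length xs

  arrowProp-reverse⁻ : (a b : Word) → length a ≡ length b → ArrowProp (a ʳ) a (b ʳ) b
  arrowProp-reverse⁻ a b len =
    subst₂ (λ a' b' → ArrowProp (a ʳ) a' (b ʳ) b') (reverse-involutive a) (reverse-involutive b)
      (arrowProp-reverse (a ʳ) (b ʳ) (trans (length-reverse a) (trans len (sym (length-reverse b)))))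

  analogy-reverse : (a b : Word) → length a ≡ length b → Analogy a (a ʳ) b (b ʳ)
  analogy-reverse a b len =
      arrowProp-reverse a b len , arrowProp-reverse⁻ a b len
    , arrowProp-reverse b a (sym len) , arrowProp-reverse⁻ b a (sym len)

mainTheorem16 : (A : Set) → FiniteNonEmpty A →
    let open WordAlgebra A in
    ((a b : Word) → length a ≡ length b → Analogy a (a ʳ) b (b ʳ))
    × ((a : Word) → Analogy a (a ʳ) (a ʳ) a)
mainTheorem16 A _ = analogy-reverse {A} , λ a →
  subst (Analogy a (a ʳ) (a ʳ)) (reverse-involutive a) (analogy-reverse {A} a (a ʳ) (sym (length-reverse a)))
  where open WordAlgebra A
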